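{- Let $h:[n]\to[n]$ be a Hessenberg function and $T=\{\ell_1<\cdots<\ell_k\}\in\mathrm{SK}_k(\Gamma_h)$. Then: (1) $\mathrm{inv}(w_T)=\{(i,j): i>j,\ i\in T\}$; (2) if $w=w_T\sigma$ with $\sigma\in\mathrm{Stab}(\ell_1,\dots,\ell_k)$, then $\mathrm{inv}(w)=\mathrm{inv}(w_T)\sqcup(\mathrm{inv}(\sigma)\cap\Phi[T])$.
   Context: $\mathrm{inv}(w)=\{(i,j):i>j,\ w(i)<w(j)\}$. Roots $t_i-t_j$ are identified with pairs $(i,j)$, and $\Phi[T]=\{t_i-t_j: i\ne j,\ \{i,j\}\cap T=\emptyset\}$. $\Gamma_h$: vertices $[n]$, edges $\{a,b\}$, $a<b\le h(a)$; $\mathrm{SK}_k(\Gamma_h)$ is the set of independent vertex sets of size $k$. $w_T\in\mathfrak{S}_n$: $w_T(\ell_j)=k-j+1$ for $1\le j\le k$, and positions in $[n]\setminus T$, read left to right, carry $k+1,\dots,n$ in increasing order. $\mathrm{Stab}(\ell_1,\dots,\ell_k)=\{\sigma\in\mathfrak{S}_n:\sigma(\ell_j)=\ell_j\ \forall j\}$; $(w_T\sigma)(a)=w_T(\sigma(a))$. -}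

module Defs where

open import Data.Nat using (ℕ; _+_; _∸_)
open import Data.Bool using (Bool; true; false; if_then_else_; _∧_; not)
open import Data.Fin using (Fin; toℕ; _<_; _≤_)
open import Data.Fin.Subset using (Subset; _∈_; _∉_; ∣_∣)
open import Data.Fin.Permutation using (Permutation′; _⟨$⟩ʳ_)
open import Data.List using (List; map; allFin)
open import Data.Nat.ListAction using (sum)
open import Data.Vec using (lookup)
open import Data.Nat using (_<ᵇ_)
open import Data.Product using (_×_)
open import Relation.Binary.PropositionalEquality using (_≡_)
open import Relation.Nullary using (¬_)

record IsHessenberg {n : ℕ} (h : Fin n → Fin n) : Set where
  field
    extensive : ∀ i → i ≤ h i
    monotone  : ∀ i j → i ≤ j → h i ≤ h j

Edge : ∀ {n} → (Fin n → Fin n) → Fin n → Fin n → Set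
Edge h a b = (a < b) × (b ≤ h a)

SK : ∀ {n} (k : ℕ) (h : Fin n → Fin n) → Subset n → Set
SK k h T = (∀ a b → a ∈ T → b ∈ T → ¬ Edge h a b) × (∣ T ∣ ≡ k)

countBelow : ∀ {n} → (Fin n → Bool) → Fin n → ℕ
countBelow {n} P a =
  sum (map (λ b → if P b ∧ (toℕ b <ᵇ toℕ a) then 1 else 0) (allFin n))

-- The permutation w_T, as its one-line function [n] → {1,…,n}:
-- writing T = {ℓ₁ < ⋯ < ℓ_k}, if a = ℓ_j then j = 1 + #{b ∈ T : b < a} and
-- w_T(a) = k − j + 1 = k − #{b ∈ T : b < a};
-- if a ∉ T then w_T(a) = k + 1 + #{b ∉ T : b < a}.
wT : ∀ {n} (k : ℕ) → Subset n → Fin n → ℕ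
wT k T a = if lookup T a
           then k ∸ countBelow (lookup T) a
           else k + 1 + countBelow (λ b → not (lookup T b)) a

InvPair : ∀ {n} → (Fin n → ℕ) → Fin n → Fin n → Set
InvPair w i j = (j < i) × (w i Data.Nat.< w j)

oneLine : ∀ {n} → Permutation′ n → Fin n → ℕ
oneLine σ a = toℕ (σ ⟨$⟩ʳ a)

wTσ : ∀ {n} (k : ℕ) → Subset n → Permutation′ n → Fin n → ℕ
wTσ k T σ a = wT k T (σ ⟨$⟩ʳ a)

Stab : ∀ {n} → Subset n → Permutation′ n → Set
Stab T σ = ∀ a → a ∈ T → σ ⟨$⟩ʳ a ≡ a

InΦ : ∀ {n} → Subset n → Fin n → Fin n → Set
InΦ T i j = ¬ (i ≡ j) × i ∉ T × j ∉ T

module Submission where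

-- Write k = |T|.  The one-line word w_T takes values ≤ k on T and values
-- > k off T; on T it is strictly decreasing (the j-th element of T gets
-- k − j + 1), and off T it is strictly increasing (order-preservingly
-- numbered by k + 1, k + 2, …).  Both monotonicity facts reduce to the
-- counting function countBelow P a = #{b < a : P b}, which is weakly
-- increasing in a, strictly so past any b with P b, and bounded by |T|
-- when P is membership in T.
--
-- From these three shape facts, for j < i:  w_T(i) < w_T(j) ⟺ i ∈ T,
-- which is part (1).  For part (2) we use that σ ∈ Stab(T) fixes T
-- pointwise and therefore (being injective) maps the complement of T into
-- itself; a case split on whether i and j lie in T then compares w_T σ
-- with w_T (when i ∈ T, or i ∉ T ∌ j) or with σ (when i, j ∉ T, using that
-- w_T is order-preserving off T).  Disjointness is immediate since
-- inversions of w_T have i ∈ T while Φ[T] requires i ∉ T.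

open import Defs
open import Data.Nat using (ℕ)
open import Data.Fin using (Fin; _<_)
open import Data.Fin.Subset using (Subset; _∈_)
open import Data.Fin.Permutation using (Permutation′)
open import Data.Product using (_×_)
open import Data.Sum using (_⊎_)
open import Function.Bundles using (_⇔_)
open import Relation.Nullary using (¬_)

import Data.Nat as Nat
open Nat using (suc; _+_; _∸_; _<ᵇ_; z≤n; s≤s)
open import Data.Nat.Properties
open import Data.Bool using (Bool; true; false; if_then_else_; _∧_; not)
open import Data.Fin using (toℕ)
open import Data.Fin.Properties using () renaming (<⇒≢ to <⇒≢ᶠ)
open import Data.Fin.Subset using (∣_∣; _∉_)
open import Data.Fin.Subset.Properties using (_∈?_)
open import Data.Fin.Permutation using (_⟨$⟩ʳ_; _⟨$⟩ˡ_; inverseˡ)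
open import Data.List using (List; []; _∷_; map; allFin; tabulate)
open import Data.List.Properties using (map-tabulate)
open import Data.Nat.ListAction using (sum)
open import Data.List.Relation.Unary.Any using (Any; here; there)
open import Data.List.Membership.Propositional.Properties using (∈-allFin)
open import Data.Vec using (lookup) renaming (_∷_ to _∷ᵥ_; [] to []ᵥ)
open import Data.Vec.Properties using ([]=⇒lookup; lookup⇒[]=)
open import Data.Product using (_,_; proj₂)
open import Data.Sum using (inj₁; inj₂)
open import Function.Bundles using (mk⇔; Equivalence)
open import Relation.Nullary using (yes; no; contradiction)
open import Relation.Nullary.Reflects using (ofʸ; ofⁿ)
open import Relation.Binary.PropositionalEquality

sum-map-mono : ∀ {X : Set} (xs : List X) {f g : X → ℕ} →
               (∀ x → f x Nat.≤ g x) → sum (map f xs) Nat.≤ sum (map g xs)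
sum-map-mono []       f≤g = z≤n
sum-map-mono (x ∷ xs) f≤g = +-mono-≤ (f≤g x) (sum-map-mono xs f≤g)

sum-map-strict : ∀ {X : Set} (xs : List X) {f g : X → ℕ} →
                 (∀ x → f x Nat.≤ g x) → ∀ {y} → Any (y ≡_) xs →
                 f y Nat.< g y → sum (map f xs) Nat.< sum (map g xs)
sum-map-strict (x ∷ xs) f≤g (here refl) fy<gy =
  +-mono-<-≤ fy<gy (sum-map-mono xs f≤g)
sum-map-strict (x ∷ xs) f≤g (there y∈xs) fy<gy =
  +-mono-≤-< (f≤g x) (sum-map-strict xs f≤g y∈xs fy<gy)

below : ∀ {n} → (Fin n → Bool) → ℕ → Fin n → ℕ
below P m b = if P b ∧ (toℕ b <ᵇ m) then 1 else 0

below-mono : ∀ {n} (P : Fin n → Bool) {m m′} → m Nat.≤ m′ →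
             ∀ b → below P m b Nat.≤ below P m′ b
below-mono P {m} {m′} m≤m′ b with P b
... | false = z≤n
... | true with toℕ b <ᵇ m | <ᵇ-reflects-< (toℕ b) m
                | toℕ b <ᵇ m′ | <ᵇ-reflects-< (toℕ b) m′
...   | false | _        | _     | _         = z≤n
...   | true  | _        | true  | _         = ≤-refl
...   | true  | ofʸ b<m  | false | ofⁿ b≮m′  = contradiction (≤-trans b<m m≤m′) b≮m′

below-jump : ∀ {n} (P : Fin n → Bool) {m} b → P b ≡ true → toℕ b Nat.< m →
             below P (toℕ b) b Nat.< below P m b
below-jump P {m} b Pb b<m rewrite Pb
  with toℕ b <ᵇ toℕ b | <ᵇ-reflects-< (toℕ b) (toℕ b)
     | toℕ b <ᵇ m     | <ᵇ-reflects-< (toℕ b) m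
... | true  | ofʸ b<b | _     | _         = contradiction b<b (n≮n (toℕ b))
... | false | _       | true  | _         = s≤s z≤n
... | false | _       | false | ofⁿ b≮m   = contradiction b<m b≮m

countBelow-mono : ∀ {n} (P : Fin n → Bool) {a b : Fin n} →
                  toℕ b Nat.≤ toℕ a → countBelow P b Nat.≤ countBelow P a
countBelow-mono {n} P b≤a = sum-map-mono (allFin n) (below-mono P b≤a)

countBelow-strict : ∀ {n} (P : Fin n → Bool) {a b : Fin n} →
                    toℕ b Nat.< toℕ a → P b ≡ true →
                    countBelow P b Nat.< countBelow P a
countBelow-strict {n} P {b = b} b<a Pb =
  sum-map-strict (allFin n) (below-mono P (<⇒≤ b<a)) (∈-allFin b)
                 (below-jump P b Pb b<a)

sum-indicator : ∀ {n} (T : Subset n) →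
                sum (tabulate (λ b → if lookup T b then 1 else 0)) ≡ ∣ T ∣
sum-indicator []ᵥ           = refl
sum-indicator (true  ∷ᵥ T) = cong suc (sum-indicator T)
sum-indicator (false ∷ᵥ T) = sum-indicator T

countBelow-≤-size : ∀ {n} (T : Subset n) a → countBelow (lookup T) a Nat.≤ ∣ T ∣
countBelow-≤-size {n} T a = begin
  countBelow (lookup T) a                                 ≤⟨ sum-map-mono (allFin n) below≤indicator ⟩
  sum (map indicator (allFin n))                          ≡⟨ cong sum (map-tabulate (λ b → b) indicator) ⟩
  sum (tabulate indicator)                                ≡⟨ sum-indicator T ⟩
  ∣ T ∣                                                   ∎
  where
  open ≤-Reasoning
  indicator : Fin n → ℕ
  indicator b = if lookup T b then 1 else 0

  below≤indicator : ∀ b → below (lookup T) (toℕ a) b Nat.≤ indicator b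
  below≤indicator b with lookup T b
  ... | false = z≤n
  ... | true with toℕ b <ᵇ toℕ a
  ...   | true  = ≤-refl
  ...   | false = z≤n

module _ {n : ℕ} (T : Subset n) where

  ∉⇒lookup : ∀ {a} → a ∉ T → lookup T a ≡ false
  ∉⇒lookup {a} a∉T with lookup T a in eq
  ... | true  = contradiction (lookup⇒[]= a T eq) a∉T
  ... | false = refl

  wT-∈ : ∀ k {a} → a ∈ T → wT k T a ≡ k ∸ countBelow (lookup T) a
  wT-∈ k a∈T rewrite []=⇒lookup a∈T = refl

  wT-∈-≤ : ∀ k {a} → a ∈ T → wT k T a Nat.≤ k
  wT-∈-≤ k {a} a∈T rewrite wT-∈ k a∈T = m∸n≤m k (countBelow (lookup T) a)

  wT-∉ : ∀ k {a} → a ∉ T →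
         wT k T a ≡ k + 1 + countBelow (λ b → not (lookup T b)) a
  wT-∉ k a∉T rewrite ∉⇒lookup a∉T = refl

  wT-∉-> : ∀ k {a} → a ∉ T → k Nat.< wT k T a
  wT-∉-> k a∉T rewrite wT-∉ k a∉T = ≤-trans (m<m+n k (s≤s z≤n)) (m≤m+n (k + 1) _)

  wT-∈<∉ : ∀ k {a b} → a ∈ T → b ∉ T → wT k T a Nat.< wT k T b
  wT-∈<∉ k a∈T b∉T = ≤-<-trans (wT-∈-≤ k a∈T) (wT-∉-> k b∉T)

  wT-decreasing-on-T : ∀ {a b} → a ∈ T → b ∈ T → b < a →
                       wT (∣ T ∣) T a Nat.< wT (∣ T ∣) T b
  wT-decreasing-on-T {a} {b} a∈T b∈T b<a
    rewrite wT-∈ ∣ T ∣ a∈T | wT-∈ ∣ T ∣ b∈T =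
    ∸-monoʳ-< (countBelow-strict (lookup T) b<a ([]=⇒lookup b∈T))
              (countBelow-≤-size T a)

  wT-increasing-off-T : ∀ k {a b} → a ∉ T → b ∉ T → a < b →
                        wT k T a Nat.< wT k T b
  wT-increasing-off-T k a∉T b∉T a<b rewrite wT-∉ k a∉T | wT-∉ k b∉T =
    +-monoʳ-< (k + 1) (countBelow-strict _ a<b (cong not (∉⇒lookup a∉T)))

  wT-order-off-T : ∀ k {a b} → a ∉ T → b ∉ T → (wT k T a Nat.< wT k T b ⇔ a < b)
  wT-order-off-T k {a} {b} a∉T b∉T = mk⇔ reflect (wT-increasing-off-T k a∉T b∉T)
    where
    reflect : wT k T a Nat.< wT k T b → a < b
    reflect wa<wb with toℕ a Nat.<? toℕ b
    ... | yes a<b = a<b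
    ... | no  a≮b = contradiction wa<wb (≤⇒≯ wb≤wa)
      where
      wb≤wa : wT k T b Nat.≤ wT k T a
      wb≤wa rewrite wT-∉ k a∉T | wT-∉ k b∉T =
        +-monoʳ-≤ (k + 1) (countBelow-mono _ (≮⇒≥ a≮b))

  wT-inversion : ∀ {i j} → j < i → (wT (∣ T ∣) T i Nat.< wT (∣ T ∣) T j ⇔ i ∈ T)
  wT-inversion {i} {j} j<i with i ∈? T | j ∈? T
  ... | yes i∈T | yes j∈T = mk⇔ (λ _ → i∈T) (λ _ → wT-decreasing-on-T i∈T j∈T j<i)
  ... | yes i∈T | no  j∉T = mk⇔ (λ _ → i∈T) (λ _ → wT-∈<∉ ∣ T ∣ i∈T j∉T)
  ... | no  i∉T | yes j∈T = mk⇔ (λ wi<wj → contradiction wi<wj (<⇒≯ (wT-∈<∉ ∣ T ∣ j∈T i∉T)))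
                                (λ i∈T → contradiction i∈T i∉T)
  ... | no  i∉T | no  j∉T =
    mk⇔ (λ wi<wj → contradiction (Equivalence.to (wT-order-off-T ∣ T ∣ i∉T j∉T) wi<wj) (<⇒≯ j<i))
        (λ i∈T → contradiction i∈T i∉T)

  wT-inversions : ∀ i j → InvPair (wT (∣ T ∣) T) i j ⇔ (j < i × i ∈ T)
  wT-inversions i j = mk⇔
    (λ (j<i , wi<wj) → j<i , Equivalence.to (wT-inversion j<i) wi<wj)
    (λ (j<i , i∈T)   → j<i , Equivalence.from (wT-inversion j<i) i∈T)

perm-injective : ∀ {n} (σ : Permutation′ n) {a b} → σ ⟨$⟩ʳ a ≡ σ ⟨$⟩ʳ b → a ≡ b
perm-injective σ {a} {b} σa≡σb = begin
  a                     ≡⟨ inverseˡ σ ⟨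
  σ ⟨$⟩ˡ (σ ⟨$⟩ʳ a)     ≡⟨ cong (σ ⟨$⟩ˡ_) σa≡σb ⟩
  σ ⟨$⟩ˡ (σ ⟨$⟩ʳ b)     ≡⟨ inverseˡ σ ⟩
  b                     ∎
  where open ≡-Reasoning

module _ {n : ℕ} (T : Subset n) (σ : Permutation′ n) (σ-fixes : Stab T σ) where

  -- σ fixes T pointwise, hence by injectivity maps the complement of T
  -- into itself.
  stab-∉ : ∀ {a} → a ∉ T → σ ⟨$⟩ʳ a ∉ T
  stab-∉ {a} a∉T σa∈T =
    a∉T (subst (_∈ T) (perm-injective σ (σ-fixes (σ ⟨$⟩ʳ a) σa∈T)) σa∈T)

  wTσ-∈ : ∀ k {a} → a ∈ T → wTσ k T σ a ≡ wT k T a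
  wTσ-∈ k {a} a∈T = cong (wT k T) (σ-fixes a a∈T)

  InvSplit : Fin n → Fin n → Set
  InvSplit i j = InvPair (wT (∣ T ∣) T) i j ⊎ (InvPair (oneLine σ) i j × InΦ T i j)

  wTσ-inversion→ : ∀ i j → InvPair (wTσ (∣ T ∣) T σ) i j → InvSplit i j
  wTσ-inversion→ i j (j<i , wσi<wσj) with i ∈? T | j ∈? T
  ... | yes i∈T | _       = inj₁ (Equivalence.from (wT-inversions T i j) (j<i , i∈T))
  ... | no  i∉T | yes j∈T =
    contradiction (subst (wTσ (∣ T ∣) T σ i Nat.<_) (wTσ-∈ (∣ T ∣) j∈T) wσi<wσj)
                  (<⇒≯ (wT-∈<∉ T (∣ T ∣) j∈T (stab-∉ i∉T)))
  ... | no  i∉T | no  j∉T =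
    inj₂ ( (j<i , Equivalence.to (wT-order-off-T T (∣ T ∣) (stab-∉ i∉T) (stab-∉ j∉T)) wσi<wσj)
         , (≢-sym (<⇒≢ᶠ j<i) , i∉T , j∉T))

  wTσ-inversion← : ∀ i j → InvSplit i j → InvPair (wTσ (∣ T ∣) T σ) i j
  wTσ-inversion← i j (inj₁ inv) with Equivalence.to (wT-inversions T i j) inv | j ∈? T
  ... | j<i , i∈T | yes j∈T
    rewrite wTσ-∈ (∣ T ∣) i∈T | wTσ-∈ (∣ T ∣) j∈T = inv
  ... | j<i , i∈T | no  j∉T
    rewrite wTσ-∈ (∣ T ∣) i∈T = j<i , wT-∈<∉ T (∣ T ∣) i∈T (stab-∉ j∉T)
  wTσ-inversion← i j (inj₂ ((j<i , σi<σj) , (_ , i∉T , j∉T))) =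
    j<i , Equivalence.from (wT-order-off-T T (∣ T ∣) (stab-∉ i∉T) (stab-∉ j∉T)) σi<σj

  wTσ-inversions : ∀ i j → InvPair (wTσ (∣ T ∣) T σ) i j ⇔ InvSplit i j
  wTσ-inversions i j = mk⇔ (wTσ-inversion→ i j) (wTσ-inversion← i j)

  inversions-disjoint :
    ∀ i j → ¬ (InvPair (wT (∣ T ∣) T) i j × (InvPair (oneLine σ) i j × InΦ T i j))
  inversions-disjoint i j (inv , (_ , (_ , i∉T , _))) =
    i∉T (proj₂ (Equivalence.to (wT-inversions T i j) inv))

-- T ∈ SK_k(Γ_h) forces k = |T|.
lemma5p21 : (n k : ℕ) (h : Fin n → Fin n) → IsHessenberg h →
    (T : Subset n) → SK k h T →
    (∀ i j → InvPair (wT k T) i j ⇔ (j < i × i ∈ T))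
    × (∀ (σ : Permutation′ n) → Stab T σ →
         ∀ i j →
           (InvPair (wTσ k T σ) i j
              ⇔ (InvPair (wT k T) i j ⊎ (InvPair (oneLine σ) i j × InΦ T i j)))
           × ¬ (InvPair (wT k T) i j × (InvPair (oneLine σ) i j × InΦ T i j)))
lemma5p21 n .(∣ T ∣) h _ T (_ , refl) =
    wT-inversions T
  , λ σ σ-fixes i j → wTσ-inversions T σ σ-fixes i j
                    , inversions-disjoint T σ σ-fixes i j
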